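{- Let $G=(V,E)$ be an undirected graph on $n$ vertices, $V=V_1\cup V_2$ a partition with $|V_1|=|V_2|=n/2$, $s\in V_1$, $m\ge0$, $L_m$ a set of $m$ new labels, and $L=V_2\cup L_m$. Take the variables $x_{uv}$, $x_{uv,d}$, the complete bidirected graph $D=(V_1,F)$ and the function $f$ as follows: variables $x_{uv}$ for ordered pairs with $uv\in E$ and $\{u,v\}\cap V_2\ne\emptyset$, and $x_{uv,d}$ for ordered pairs with $uv$ an edge of $G[V_1]$ and $d\in L_m$, over $GF(2)$, with $x_{uv}=x_{vu}$ and $x_{uv,d}=x_{vu,d}$ whenever $u\neq s\neq v$; $f(uv,X)=\sum_{P\in\mathcal{P}_{u,v}(X)}\prod_{wz\in P}x_{wz}$ for $uv\in F$ and nonempty $X\subseteq V_2$, $f(uv,\{d\})=x_{uv,d}$ for $uv\in F$ an edge of $G[V_1]$ and $d\in L_m$, and $f=0$ elsewhere. Define $g$ (depending on an indeterminate $r$) by \[g(uv,X,r)=\sum_{k=|X|}^{n} r^k\sum_{\substack{W\in\mathcal{W}_{u,v}(X,k+1)\\ S_X(W)=X}}\ \prod_{wz\in W}x_{wz}\] for $uv\in F$ and nonempty $X\subseteq V_2$; $g(uv,\{d\},r)=r\,x_{uv,d}$ for $uv\in F$ an edge of $G[V_1]$ and $d\in L_m$; and $g=0$ elsewhere. With $\mathbf{M}_h(Z)$ the $V_1\times V_1$ matrix with entries $\mathbf{M}_h(Z)_{i,j}=h(ij,Z)$ for $ij\in F$, $Z\neq\emptyset$, and $0$ otherwise, let \[p(f,r)=\sum_{Y\subseteq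 L}\det\Big(\sum_{Z\subseteq Y}r^{|Z|}\mathbf{M}_f(Z)\Big),\qquad q(g,r)=\sum_{Y\subseteq L}\det\Big(\sum_{Z\subseteq Y}\mathbf{M}_{g(\cdot,\cdot,r)}(Z)\Big).\] Then the coefficient of $r^{|L|}$ in $q(g,r)$ equals the coefficient of $r^{|L|}$ in $p(f,r)$.
   Context: For $u,v\in V$ and nonempty $X\subseteq V$, $\mathcal{P}_{u,v}(X)$ is the set of simple paths in $G$ from $u$ to $v$ whose internal vertices are exactly $X$; products over $wz\in P$ are over the arcs of $P$ oriented from $u$ to $v$. $\mathcal{W}_{u,v}(X,l)$ is the set of walks $W=(u,w_1,\dots,w_{l-1},v)$ of length $l$ in $G$ from $u$ to $v$ with all internal vertices $w_1,\dots,w_{l-1}$ in $X$; its support is $S_X(W)=\{w_1,\dots,w_{l-1}\}$, and $\prod_{wz\in W}$ is over the $l$ consecutive arcs of the walk, with multiplicity. All computations are in the polynomial ring over $GF(2)$ in the variables $x$ and $r$. -}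

module Defs where

open import Level using (Level)
open import Data.Bool using (Bool; true; false; _∧_; _∨_; not; if_then_else_)
open import Data.Nat as ℕ using (ℕ; zero; suc)
open import Data.Fin as Fin using (Fin; zero; suc; punchIn; toℕ)
open import Data.Fin.Subset using (Subset; ⊥; ⁅_⁆; _∪_; ∣_∣)
open import Data.Vec as Vec using (Vec; []; _∷_)
open import Data.List as List using (List; []; _∷_; _++_)
open import Data.Sum using (_⊎_; inj₁; inj₂)
open import Algebra.Bundles using (CommutativeRing)

_==F_ : ∀ {k} → Fin k → Fin k → Bool
zero ==F zero = true
zero ==F suc _ = false
suc _ ==F zero = false
suc a ==F suc b = a ==F b

_==V_ : ∀ {h} → Fin h ⊎ Fin h → Fin h ⊎ Fin h → Bool
inj₁ a ==V inj₁ b = a ==F b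
inj₂ a ==V inj₂ b = a ==F b
_ ==V _ = false

_==B_ : Bool → Bool → Bool
true ==B b = b
false ==B b = not b

_==S_ : ∀ {k} → Subset k → Subset k → Bool
[] ==S [] = true
(a ∷ p) ==S (b ∷ q) = (a ==B b) ∧ (p ==S q)

_⊆B_ : ∀ {k} → Subset k → Subset k → Bool
[] ⊆B [] = true
(a ∷ p) ⊆B (b ∷ q) = (not a ∨ b) ∧ (p ⊆B q)

isEmptyS : ∀ {k} → Subset k → Bool
isEmptyS p = p ==S ⊥

allSubsets : ∀ k → List (Subset k)
allSubsets zero = [] ∷ []
allSubsets (suc k) =
  List.map (true ∷_) (allSubsets k) ++ List.map (false ∷_) (allSubsets k)

allVecs : ∀ h l → List (Vec (Fin h) l)
allVecs h zero = [] ∷ []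
allVecs h (suc l) =
  List.concatMap (λ a → List.map (a ∷_) (allVecs h l)) (List.allFin h)

support : ∀ {h l} → Vec (Fin h) l → Subset h
support [] = ⊥
support (w ∷ ws) = ⁅ w ⁆ ∪ support ws

elemB : ∀ {h l} → Fin h → Vec (Fin h) l → Bool
elemB a [] = false
elemB a (w ∷ ws) = (a ==F w) ∨ elemB a ws

distinct : ∀ {h l} → Vec (Fin h) l → Bool
distinct [] = true
distinct (w ∷ ws) = not (elemB w ws) ∧ distinct ws

module Construction {c ℓ : Level} (R : CommutativeRing c ℓ) where
  open CommutativeRing R using (Carrier; _+_; _*_; -_; 0#; 1#)

  sumL : List Carrier → Carrier
  sumL = List.foldr _+_ 0#

  sumFin : ∀ k → (Fin k → Carrier) → Carrier
  sumFin k f = sumL (List.map f (List.allFin k))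

  when : Bool → Carrier → Carrier
  when b a = if b then a else 0#

  -- polynomials in r: coefficient lists, constant term first
  Poly : Set c
  Poly = List Carrier

  _⊕_ : Poly → Poly → Poly
  [] ⊕ q = q
  (a ∷ p) ⊕ [] = a ∷ p
  (a ∷ p) ⊕ (b ∷ q) = (a + b) ∷ (p ⊕ q)

  _⊗_ : Poly → Poly → Poly
  [] ⊗ q = []
  (a ∷ p) ⊗ q = List.map (a *_) q ⊕ (0# ∷ (p ⊗ q))

  ⊖_ : Poly → Poly
  ⊖ p = List.map (-_) p

  0P 1P : Poly
  0P = []
  1P = 1# ∷ []

  mono : ℕ → Carrier → Poly
  mono zero a = a ∷ []
  mono (suc k) a = 0# ∷ mono k a

  coeff : Poly → ℕ → Carrier
  coeff [] k = 0#
  coeff (a ∷ p) zero = a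
  coeff (a ∷ p) (suc k) = coeff p k

  sumP : List Poly → Poly
  sumP = List.foldr _⊕_ 0P

  signed : ℕ → Poly → Poly
  signed zero p = p
  signed (suc j) p = ⊖ signed j p

  det : ∀ k → (Fin k → Fin k → Poly) → Poly
  det zero M = 1P
  det (suc k) M =
    sumP (List.map (λ j → signed (toℕ j)
                            (M zero j ⊗ det k (λ a b → M (suc a) (punchIn j b))))
                   (List.allFin (suc k)))

  -- The setting of the lemma.
  -- V = V₁ ⊎ V₂ with V₁ = inj₁ (Fin h), V₂ = inj₂ (Fin h); n = h + h.
  -- L_m = Fin m;  L = V₂ ⊎ L_m;  a subset of L is a pair (Subset h , Subset m).

  module Setting (h m : ℕ)
                 (adj : Fin h ⊎ Fin h → Fin h ⊎ Fin h → Bool)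
                 (xE : Fin h ⊎ Fin h → Fin h ⊎ Fin h → Carrier)
                 (xL : Fin h → Fin h → Fin m → Carrier) where

    V : Set
    V = Fin h ⊎ Fin h

    n : ℕ
    n = h ℕ.+ h

    prodArcs : List V → Carrier
    prodArcs (a ∷ b ∷ rest) = xE a b * prodArcs (b ∷ rest)
    prodArcs _ = 1#

    isWalk : List V → Bool
    isWalk (a ∷ b ∷ rest) = adj a b ∧ isWalk (b ∷ rest)
    isWalk _ = true

    seqOf : ∀ {l} → Fin h → Vec (Fin h) l → Fin h → List V
    seqOf u ws v = inj₁ u ∷ (List.map inj₂ (Vec.toList ws) ++ inj₁ v ∷ [])

    -- Σ_{P ∈ 𝒫_{u,v}(X)} ∏_{wz∈P} x_{wz}   (X ⊆ V₂)
    pathSum : Fin h → Fin h → Subset h → Carrier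
    pathSum u v X =
      sumL (List.map (λ ws → when (distinct ws ∧ (support ws ==S X) ∧ isWalk (seqOf u ws v))
                                  (prodArcs (seqOf u ws v)))
                     (allVecs h ∣ X ∣))

    -- Σ_{W ∈ 𝒲_{u,v}(X,k+1), S_X(W) = X} ∏_{wz∈W} x_{wz}
    walkSum : Fin h → Fin h → Subset h → (k : ℕ) → Carrier
    walkSum u v X k =
      sumL (List.map (λ ws → when ((support ws ==S X) ∧ isWalk (seqOf u ws v))
                                  (prodArcs (seqOf u ws v)))
                     (allVecs h k))

    -- [ Z₂ = ∅ ∧ Zₘ = {d} ∧ uv ∈ E(G[V₁]) ] · x_{uv,d}, summed over d
    labelTerm : Fin h → Fin h → Subset h → Subset m → Carrier
    labelTerm u v Z₂ Zₘ =
      sumFin m (λ d → when (isEmptyS Z₂ ∧ (Zₘ ==S ⁅ d ⁆) ∧ adj (inj₁ u) (inj₁ v)) (xL u v d))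

    f : Fin h → Fin h → Subset h → Subset m → Carrier
    f u v Z₂ Zₘ =
      when (isEmptyS Zₘ ∧ not (isEmptyS Z₂)) (pathSum u v Z₂) + labelTerm u v Z₂ Zₘ

    g : Fin h → Fin h → Subset h → Subset m → Poly
    g u v Z₂ Zₘ =
      (if isEmptyS Zₘ ∧ not (isEmptyS Z₂)
         then sumP (List.map (λ k → if ∣ Z₂ ∣ ℕ.≤ᵇ k then mono k (walkSum u v Z₂ k) else 0P)
                             (List.upTo (suc n)))
         else 0P)
      ⊕ mono 1 (labelTerm u v Z₂ Zₘ)

    -- 𝐌_f(Z) and 𝐌_g(Z): zero on the diagonal (F has no loops)
    offDiag : Fin h → Fin h → Poly → Poly
    offDiag i j a = if i ==F j then 0P else a

    sumSub : Subset h → Subset m → (Subset h → Subset m → Poly) → Poly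
    sumSub Y₂ Yₘ F =
      sumP (List.concatMap
              (λ Z₂ → List.map (λ Zₘ → if (Z₂ ⊆B Y₂) ∧ (Zₘ ⊆B Yₘ) then F Z₂ Zₘ else 0P)
                               (allSubsets m))
              (allSubsets h))

    sumY : (Subset h → Subset m → Poly) → Poly
    sumY F = sumP (List.concatMap (λ Y₂ → List.map (F Y₂) (allSubsets m)) (allSubsets h))

    -- p(f,r) = Σ_{Y⊆L} det( Σ_{Z⊆Y} r^{|Z|} 𝐌_f(Z) )
    p : Poly
    p = sumY (λ Y₂ Yₘ → det h (λ i j →
          sumSub Y₂ Yₘ (λ Z₂ Zₘ → offDiag i j (mono (∣ Z₂ ∣ ℕ.+ ∣ Zₘ ∣) (f i j Z₂ Zₘ)))))

    -- q(g,r) = Σ_{Y⊆L} det( Σ_{Z⊆Y} 𝐌_{g(·,·,r)}(Z) )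
    q : Poly
    q = sumY (λ Y₂ Yₘ → det h (λ i j →
          sumSub Y₂ Yₘ (λ Z₂ Zₘ → offDiag i j (g i j Z₂ Zₘ))))

module Submission where

open import Defs
open import Data.Bool using (Bool; true)
open import Data.Nat using (ℕ) renaming (_+_ to _ℕ+_)
open import Data.Fin using (Fin)
open import Data.Empty using (⊥)
open import Data.Sum using (_⊎_; inj₁; inj₂)
open import Relation.Binary.PropositionalEquality using (_≡_; _≢_)
open import Algebra.Bundles using (CommutativeRing)

open import Level using (_⊔_) renaming (suc to lsuc)
open import Algebra.Bundles using (Ring; CommutativeMonoid)
open import Data.Bool using (false)
open import Data.Nat using (zero; suc; _≤_)
open import Data.Fin using (zero; suc; toℕ; punchIn)
open import Data.List as List using (List; []; _∷_; _++_)
open import Relation.Binary.PropositionalEquality using (subst)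
import Relation.Binary.Reasoning.Setoid

-- Call a polynomial in r "of order d" if r^d divides it.  Every Z-term of the matrix in q,
-- 𝐌_g(Z), has order |Z| and the same r^|Z| coefficient as the Z-term r^|Z|·𝐌_f(Z) in p:
-- the label parts coincide, and a walk of length |X|+1 whose interior covers X repeats no
-- vertex (pigeonhole), so it is a path.  Next, call a family F of polynomials indexed by
-- the subsets Y ⊆ L "of order d" if its Möbius transform μF(Z) has order d + |Z| for all Z.
-- These orders form a ring filtration of the pointwise ring of families, so determinants
-- of matrices whose entries agree modulo order 1 agree modulo order 1; the zeta transform
-- Y ↦ Σ_{Z ⊆ Y} G(Z) has order d when every G(Z) has order d + |Z|; and in characteristic
-- 2, Σ_Y F(Y) = μF(L), so the coefficient of r^(|L|+d) in Σ_Y F(Y) vanishes when F has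
-- order d + 1.  Applied to the matrices of q and p, this is the lemma.
--
-- Subsets of L = V₂ ∪ L_m are pairs, so we lift twice: over L_m, then V₂.

HasCharacteristic2 : ∀ {c ℓ} → CommutativeRing c ℓ → Set ℓ
HasCharacteristic2 R = 1# + 1# ≈ 0#
  where open CommutativeRing R

module RingFacts {c ℓ} (T : Ring c ℓ) where
  open Ring T
  open import Algebra.Properties.Ring T using (-‿+-comm; x[y-z]≈xy-xz; [y-z]x≈yx-zx)
  open import Algebra.Properties.CommutativeSemigroup +-commutativeSemigroup using (interchange)
  open import Relation.Binary.Reasoning.Setoid setoid

  sub-+ : ∀ a b a' b' → (a + b) - (a' + b') ≈ (a - a') + (b - b')
  sub-+ a b a' b' = begin
    (a + b) + - (a' + b')   ≈⟨ +-congˡ (-‿+-comm a' b') ⟨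
    (a + b) + (- a' + - b') ≈⟨ interchange a b (- a') (- b') ⟩
    (a - a') + (b - b')     ∎

  sub-neg : ∀ a b → - a - - b ≈ - (a - b)
  sub-neg a b = -‿+-comm a (- b)

  sub-add : ∀ a b → (a - b) + b ≈ a
  sub-add a b = begin
    (a + - b) + b  ≈⟨ +-assoc a (- b) b ⟩
    a + (- b + b)  ≈⟨ +-congˡ (-‿inverseˡ b) ⟩
    a + 0#         ≈⟨ +-identityʳ a ⟩
    a              ∎

  add-sub : ∀ a b → (a + b) - b ≈ a
  add-sub a b = begin
    (a + b) + - b  ≈⟨ +-assoc a b (- b) ⟩
    a + (b - b)    ≈⟨ +-congˡ (-‿inverseʳ b) ⟩
    a + 0#         ≈⟨ +-identityʳ a ⟩
    a              ∎

  telescope : ∀ a b d → (a - b) + (b - d) ≈ a - d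
  telescope a b d = begin
    (a - b) + (b + - d)  ≈⟨ +-assoc (a - b) b (- d) ⟨
    ((a - b) + b) + - d  ≈⟨ +-congʳ (sub-add a b) ⟩
    a - d                ∎

  sub-* : ∀ a b a' b' → a * b - a' * b' ≈ (a - a') * b + a' * (b - b')
  sub-* a b a' b' = sym (begin
    (a - a') * b + a' * (b - b')          ≈⟨ +-cong ([y-z]x≈yx-zx b a a') (x[y-z]≈xy-xz a' b b') ⟩
    (a * b - a' * b) + (a' * b - a' * b') ≈⟨ telescope (a * b) (a' * b) (a' * b') ⟩
    a * b - a' * b'                       ∎)

module ListSums {c ℓ} (M : CommutativeMonoid c ℓ) where
  open CommutativeMonoid M
  open import Data.Nat using (_<_; s≤s)
  open import Data.Nat.Properties using (suc-injective)
  open import Data.Fin.Subset using (Subset; inside; outside)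
  open import Data.Vec using (_∷_)
  open import Data.List.Properties using (map-++; map-∘)
  import Relation.Binary.PropositionalEquality as ≡
  open import Relation.Binary.Reasoning.Setoid setoid

  sum : List Carrier → Carrier
  sum = List.foldr _∙_ ε

  sum-++ : ∀ xs ys → sum (xs ++ ys) ≈ sum xs ∙ sum ys
  sum-++ []       ys = sym (identityˡ _)
  sum-++ (x ∷ xs) ys = trans (∙-congˡ (sum-++ xs ys)) (sym (assoc x _ _))

  sum-cong : ∀ {a} {X : Set a} {f g : X → Carrier} l → (∀ x → f x ≈ g x) →
             sum (List.map f l) ≈ sum (List.map g l)
  sum-cong []      f≈g = refl
  sum-cong (x ∷ l) f≈g = ∙-cong (f≈g x) (sum-cong l f≈g)

  sum-zero : ∀ {a} {X : Set a} {f : X → Carrier} l → (∀ x → f x ≈ ε) → sum (List.map f l) ≈ ε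
  sum-zero []      f≈ε = refl
  sum-zero (x ∷ l) f≈ε = trans (∙-cong (f≈ε x) (sum-zero l f≈ε)) (identityˡ ε)

  sum-or-zero : ∀ {a p} {X : Set a} {P : Set p} {f : X → Carrier} l → (∀ x → P ⊎ f x ≈ ε) →
                P ⊎ sum (List.map f l) ≈ ε
  sum-or-zero []      alt = inj₂ refl
  sum-or-zero (x ∷ l) alt with alt x | sum-or-zero l alt
  ... | inj₁ px  | _         = inj₁ px
  ... | inj₂ _   | inj₁ px   = inj₁ px
  ... | inj₂ fx≈ε | inj₂ Σ≈ε = inj₂ (trans (∙-cong fx≈ε Σ≈ε) (identityˡ ε))

  sum-concat : ∀ {a} {X : Set a} (g : X → List Carrier) l →
               sum (List.concatMap g l) ≈ sum (List.map (λ x → sum (g x)) l)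
  sum-concat g []      = refl
  sum-concat g (x ∷ l) = trans (sum-++ (g x) (List.concatMap g l)) (∙-congˡ (sum-concat g l))

  sum-subsets : ∀ k (F : Subset (suc k) → Carrier) →
                sum (List.map F (allSubsets (suc k))) ≈
                sum (List.map (λ Y → F (inside ∷ Y)) (allSubsets k)) ∙ sum (List.map (λ Y → F (outside ∷ Y)) (allSubsets k))
  sum-subsets k F = begin
    sum (List.map F (List.map (inside ∷_) Ys ++ List.map (outside ∷_) Ys))
      ≡⟨ ≡.cong sum (map-++ F (List.map (inside ∷_) Ys) _) ⟩
    sum (List.map F (List.map (inside ∷_) Ys) ++ List.map F (List.map (outside ∷_) Ys))
      ≈⟨ sum-++ (List.map F (List.map (inside ∷_) Ys)) _ ⟩
    sum (List.map F (List.map (inside ∷_) Ys)) ∙ sum (List.map F (List.map (outside ∷_) Ys))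
      ≡⟨ ≡.cong₂ (λ u v → sum u ∙ sum v) (≡.sym (map-∘ Ys)) (≡.sym (map-∘ Ys)) ⟩
    sum (List.map (λ Y → F (inside ∷ Y)) Ys) ∙ sum (List.map (λ Y → F (outside ∷ Y)) Ys)
      ∎
    where Ys = allSubsets k

  sum-applyUpTo-zero : ∀ (ψ : ℕ → Carrier) N → (∀ k → ψ k ≈ ε) → sum (List.applyUpTo ψ N) ≈ ε
  sum-applyUpTo-zero ψ zero    ψ≈ε = refl
  sum-applyUpTo-zero ψ (suc N) ψ≈ε =
    trans (∙-cong (ψ≈ε 0) (sum-applyUpTo-zero (λ k → ψ (suc k)) N (λ k → ψ≈ε (suc k)))) (identityˡ ε)

  sum-single : ∀ (ψ : ℕ → Carrier) N e → e < N → (∀ k → k ≢ e → ψ k ≈ ε) →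
               sum (List.applyUpTo ψ N) ≈ ψ e
  sum-single ψ (suc N) zero    _         others =
    trans (∙-congˡ (sum-applyUpTo-zero (λ k → ψ (suc k)) N (λ k → others (suc k) λ ())))
          (identityʳ (ψ zero))
  sum-single ψ (suc N) (suc e) (s≤s e<N) others =
    trans (∙-cong (others zero λ ()) (sum-single (λ k → ψ (suc k)) N e e<N
                                        (λ k k≢e → others (suc k) (λ k+1≡e+1 → k≢e (suc-injective k+1≡e+1)))))
          (identityˡ _)

module Supports where
  open import Data.Bool.Properties using (∧-conicalˡ; ∧-conicalʳ)
  open import Data.Nat using (_<_; s≤s)
  open import Data.Nat.Properties using (≤-trans; ≤-reflexive; <-irrefl)
  open import Data.Fin.Subset using (Subset; ⁅_⁆; _∪_; ∣_∣; _∈_; inside; outside) renaming (⊥ to ∅)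
  open import Data.Fin.Subset.Properties
    using (∣⊥∣≡0; ∣p∣≤∣x∷p∣; ∪-identityˡ; x∈⁅x⁆; x∈⁅y⁆⇒x≡y; x∈p∪q⁻; x∈p∪q⁺; p⊆q⇒∣p∣≤∣q∣)
  open import Data.Vec using (Vec; []; _∷_)
  open import Data.Sum using ([_,_])
  open import Data.Empty using (⊥-elim)
  open import Function using (id)
  open import Relation.Binary.PropositionalEquality using (refl; sym; trans; cong; cong₂; subst)

  ==B-sound : ∀ a b → (a ==B b) ≡ true → a ≡ b
  ==B-sound true  true  _ = refl
  ==B-sound false false _ = refl

  ==S-sound : ∀ {k} (p q : Subset k) → (p ==S q) ≡ true → p ≡ q
  ==S-sound []      []      _ = refl
  ==S-sound (a ∷ p) (b ∷ q) e =
    cong₂ _∷_ (==B-sound a b (∧-conicalˡ _ _ e)) (==S-sound p q (∧-conicalʳ (a ==B b) _ e))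

  ==F-sound : ∀ {k} (a b : Fin k) → (a ==F b) ≡ true → a ≡ b
  ==F-sound zero    zero    _ = refl
  ==F-sound (suc a) (suc b) e = cong suc (==F-sound a b e)

  empty-card : ∀ {k} (p : Subset k) → isEmptyS p ≡ true → ∣ p ∣ ≡ 0
  empty-card {k} p e = trans (cong ∣_∣ (==S-sound p ∅ e)) (∣⊥∣≡0 k)

  ∪-singleton-card : ∀ {k} (w : Fin k) S → ∣ ⁅ w ⁆ ∪ S ∣ ≤ suc ∣ S ∣
  ∪-singleton-card zero    (b ∷ S)       rewrite ∪-identityˡ S = s≤s (∣p∣≤∣x∷p∣ b S)
  ∪-singleton-card (suc w) (inside ∷ S)  = s≤s (∪-singleton-card w S)
  ∪-singleton-card (suc w) (outside ∷ S) = ∪-singleton-card w S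

  ∪-member-card : ∀ {k} {w : Fin k} {S} → w ∈ S → ∣ ⁅ w ⁆ ∪ S ∣ ≤ ∣ S ∣
  ∪-member-card {w = w} {S} w∈S = p⊆q⇒∣p∣≤∣q∣ λ x∈ →
    [ (λ x∈⁅w⁆ → subst (_∈ S) (sym (x∈⁅y⁆⇒x≡y w x∈⁅w⁆)) w∈S) , id ] (x∈p∪q⁻ ⁅ w ⁆ S x∈)

  elem⇒∈support : ∀ {k l} (w : Fin k) (ws : Vec (Fin k) l) → elemB w ws ≡ true → w ∈ support ws
  elem⇒∈support w (w' ∷ ws) e with w ==F w' in w≟w'
  ... | true  = x∈p∪q⁺ (inj₁ (subst (λ z → w ∈ ⁅ z ⁆) (==F-sound w w' w≟w') (x∈⁅x⁆ w)))
  ... | false = x∈p∪q⁺ (inj₂ (elem⇒∈support w ws e))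

  support-card : ∀ {k l} (ws : Vec (Fin k) l) → ∣ support ws ∣ ≤ l
  support-card {k} []       = ≤-reflexive (∣⊥∣≡0 k)
  support-card     (w ∷ ws) = ≤-trans (∪-singleton-card w (support ws)) (s≤s (support-card ws))

  support-card-< : ∀ {k l} (ws : Vec (Fin k) l) → distinct ws ≡ false → ∣ support ws ∣ < l
  support-card-< (w ∷ ws) d with elemB w ws in w∈ws
  ... | true  = s≤s (≤-trans (∪-member-card (elem⇒∈support w ws w∈ws)) (support-card ws))
  ... | false = s≤s (≤-trans (∪-singleton-card w (support ws)) (support-card-< ws d))

  pigeonhole : ∀ {k l} (ws : Vec (Fin k) l) → ∣ support ws ∣ ≡ l → distinct ws ≡ true
  pigeonhole ws spans with distinct ws in d
  ... | true  = refl
  ... | false = ⊥-elim (<-irrefl spans (support-card-< ws d))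

module Polynomials {c ℓ} (R : CommutativeRing c ℓ) where
  open CommutativeRing R
  open Construction R
  open import Data.Product using (_,_)
  open import Relation.Binary.Structures using (IsEquivalence)
  open import Relation.Binary.Bundles using (Setoid)
  open import Algebra.Structures using (IsAbelianGroup)
  open import Algebra.Bundles using (AbelianGroup)
  import Algebra.Properties.CommutativeSemigroup as CommutativeSemigroupProperties
  import Relation.Binary.PropositionalEquality as ≡
  open import Data.Empty using (⊥-elim)
  import Relation.Binary.Reasoning.Setoid as SetoidReasoning
  open import Algebra.Properties.Ring ring using (-0#≈0#)

  infix 4 _≋_
  record _≋_ (p q : Poly) : Set ℓ where
    constructor coeffwise
    field at : ∀ k → coeff p k ≈ coeff q k
  open _≋_ public

  ≋-refl : ∀ {p} → p ≋ p
  ≋-refl = coeffwise λ k → refl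

  ≋-sym : ∀ {p q} → p ≋ q → q ≋ p
  ≋-sym e = coeffwise λ k → sym (at e k)

  ≋-trans : ∀ {p q r} → p ≋ q → q ≋ r → p ≋ r
  ≋-trans e e' = coeffwise λ k → trans (at e k) (at e' k)

  ≋-isEquivalence : IsEquivalence _≋_
  ≋-isEquivalence = record { refl = ≋-refl ; sym = ≋-sym ; trans = ≋-trans }

  ≋-setoid : Setoid c ℓ
  ≋-setoid = record { isEquivalence = ≋-isEquivalence }

  scale : Carrier → Poly → Poly
  scale a = List.map (a *_)

  coeff-⊕ : ∀ p q k → coeff (p ⊕ q) k ≈ coeff p k + coeff q k
  coeff-⊕ []      q       k       = sym (+-identityˡ _)
  coeff-⊕ (a ∷ p) []      k       = sym (+-identityʳ _)
  coeff-⊕ (a ∷ p) (b ∷ q) zero    = refl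
  coeff-⊕ (a ∷ p) (b ∷ q) (suc k) = coeff-⊕ p q k

  coeff-⊖ : ∀ p k → coeff (⊖ p) k ≈ - coeff p k
  coeff-⊖ []      k       = sym -0#≈0#
  coeff-⊖ (a ∷ p) zero    = refl
  coeff-⊖ (a ∷ p) (suc k) = coeff-⊖ p k

  coeff-scale : ∀ a p k → coeff (scale a p) k ≈ a * coeff p k
  coeff-scale a []      k       = sym (zeroʳ a)
  coeff-scale a (b ∷ p) zero    = refl
  coeff-scale a (b ∷ p) (suc k) = coeff-scale a p k

  ∷-cong : ∀ {a b p q} → a ≈ b → p ≋ q → (a ∷ p) ≋ (b ∷ q)
  ∷-cong a≈b p≋q = coeffwise λ { zero → a≈b ; (suc k) → at p≋q k }

  0∷[]≋[] : (0# ∷ []) ≋ []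
  0∷[]≋[] = coeffwise λ { zero → refl ; (suc k) → refl }

  ∷-tail : ∀ {a b p q} → (a ∷ p) ≋ (b ∷ q) → p ≋ q
  ∷-tail e = coeffwise λ k → at e (suc k)

  ⊕-cong : ∀ {p p' q q'} → p ≋ p' → q ≋ q' → (p ⊕ q) ≋ (p' ⊕ q')
  ⊕-cong {p} {p'} {q} {q'} p≋p' q≋q' = coeffwise λ k →
    trans (coeff-⊕ p q k) (trans (+-cong (at p≋p' k) (at q≋q' k)) (sym (coeff-⊕ p' q' k)))

  ⊖-cong : ∀ {p q} → p ≋ q → (⊖ p) ≋ (⊖ q)
  ⊖-cong {p} {q} p≋q = coeffwise λ k → trans (coeff-⊖ p k) (trans (-‿cong (at p≋q k)) (sym (coeff-⊖ q k)))

  scale-congˡ : ∀ {a b} p → a ≈ b → scale a p ≋ scale b p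
  scale-congˡ {a} {b} p a≈b = coeffwise λ k →
    trans (coeff-scale a p k) (trans (*-congʳ a≈b) (sym (coeff-scale b p k)))

  scale-congʳ : ∀ a {p q} → p ≋ q → scale a p ≋ scale a q
  scale-congʳ a {p} {q} p≋q = coeffwise λ k →
    trans (coeff-scale a p k) (trans (*-congˡ (at p≋q k)) (sym (coeff-scale a q k)))

  ⊕-identityʳ : ∀ p → (p ⊕ []) ≋ p
  ⊕-identityʳ []      = coeffwise λ k → refl
  ⊕-identityʳ (a ∷ p) = coeffwise λ k → refl

  ⊕-isAbelianGroup : IsAbelianGroup _≋_ _⊕_ 0P ⊖_
  ⊕-isAbelianGroup = record
    { isGroup = record
      { isMonoid = record
        { isSemigroup = record
          { isMagma = record { isEquivalence = ≋-isEquivalence ; ∙-cong = ⊕-cong }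
          ; assoc = λ p q r → coeffwise λ k → begin
              coeff ((p ⊕ q) ⊕ r) k                 ≈⟨ trans (coeff-⊕ (p ⊕ q) r k) (+-congʳ (coeff-⊕ p q k)) ⟩
              (coeff p k + coeff q k) + coeff r k   ≈⟨ +-assoc _ _ _ ⟩
              coeff p k + (coeff q k + coeff r k)   ≈⟨ trans (coeff-⊕ p (q ⊕ r) k) (+-congˡ (coeff-⊕ q r k)) ⟨
              coeff (p ⊕ (q ⊕ r)) k                 ∎ }
        ; identity = (λ p → coeffwise λ k → refl) , ⊕-identityʳ }
      ; inverse = (λ p → coeffwise λ k → trans (coeff-⊕ (⊖ p) p k) (trans (+-congʳ (coeff-⊖ p k)) (-‿inverseˡ _)))
                , (λ p → coeffwise λ k → trans (coeff-⊕ p (⊖ p) k) (trans (+-congˡ (coeff-⊖ p k)) (-‿inverseʳ _)))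
      ; ⁻¹-cong = ⊖-cong }
    ; comm = λ p q → coeffwise λ k → trans (coeff-⊕ p q k) (trans (+-comm _ _) (sym (coeff-⊕ q p k))) }
    where open SetoidReasoning setoid

  ⊕-abelianGroup : AbelianGroup c ℓ
  ⊕-abelianGroup = record { isAbelianGroup = ⊕-isAbelianGroup }

  open CommutativeSemigroupProperties (AbelianGroup.commutativeSemigroup ⊕-abelianGroup)
    using () renaming (interchange to ⊕-interchange)
  module ≋-Reasoning = SetoidReasoning ≋-setoid

  scale-⊕ : ∀ a p q → scale a (p ⊕ q) ≋ (scale a p ⊕ scale a q)
  scale-⊕ a p q = coeffwise λ k → begin
    coeff (scale a (p ⊕ q)) k             ≈⟨ trans (coeff-scale a (p ⊕ q) k) (*-congˡ (coeff-⊕ p q k)) ⟩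
    a * (coeff p k + coeff q k)           ≈⟨ distribˡ a _ _ ⟩
    a * coeff p k + a * coeff q k         ≈⟨ trans (coeff-⊕ (scale a p) (scale a q) k) (+-cong (coeff-scale a p k) (coeff-scale a q k)) ⟨
    coeff (scale a p ⊕ scale a q) k       ∎
    where open SetoidReasoning setoid

  scale-+ : ∀ a b p → scale (a + b) p ≋ (scale a p ⊕ scale b p)
  scale-+ a b p = coeffwise λ k → begin
    coeff (scale (a + b) p) k             ≈⟨ coeff-scale (a + b) p k ⟩
    (a + b) * coeff p k                   ≈⟨ distribʳ _ a b ⟩
    a * coeff p k + b * coeff p k         ≈⟨ trans (coeff-⊕ (scale a p) (scale b p) k) (+-cong (coeff-scale a p k) (coeff-scale b p k)) ⟨
    coeff (scale a p ⊕ scale b p) k       ∎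
    where open SetoidReasoning setoid

  scale-* : ∀ a b p → scale a (scale b p) ≋ scale (a * b) p
  scale-* a b p = coeffwise λ k → begin
    coeff (scale a (scale b p)) k   ≈⟨ trans (coeff-scale a (scale b p) k) (*-congˡ (coeff-scale b p k)) ⟩
    a * (b * coeff p k)             ≈⟨ *-assoc a b _ ⟨
    (a * b) * coeff p k             ≈⟨ coeff-scale (a * b) p k ⟨
    coeff (scale (a * b) p) k       ∎
    where open SetoidReasoning setoid

  scale-1# : ∀ p → scale 1# p ≋ p
  scale-1# p = coeffwise λ k → trans (coeff-scale 1# p k) (*-identityˡ _)

  scale-0# : ∀ p → scale 0# p ≋ []
  scale-0# p = coeffwise λ k → trans (coeff-scale 0# p k) (zeroˡ _)

  ⊗-zeroˡ : ∀ p q → p ≋ [] → (p ⊗ q) ≋ []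
  ⊗-zeroˡ []      q p≋[] = ≋-refl
  ⊗-zeroˡ (a ∷ p) q p≋[] = begin
    scale a q ⊕ (0# ∷ p ⊗ q)  ≈⟨ ⊕-cong (scale-congˡ q (at p≋[] 0))
                                        (∷-cong refl (⊗-zeroˡ p q (coeffwise λ k → at p≋[] (suc k)))) ⟩
    scale 0# q ⊕ (0# ∷ [])    ≈⟨ ⊕-cong (scale-0# q) 0∷[]≋[] ⟩
    []                        ∎
    where open ≋-Reasoning

  ⊗-congˡ : ∀ p p' q → p ≋ p' → (p ⊗ q) ≋ (p' ⊗ q)
  ⊗-congˡ []      []        q e = ≋-refl
  ⊗-congˡ []      (a' ∷ p') q e = ≋-sym (⊗-zeroˡ (a' ∷ p') q (≋-sym e))
  ⊗-congˡ (a ∷ p) []        q e = ⊗-zeroˡ (a ∷ p) q e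
  ⊗-congˡ (a ∷ p) (a' ∷ p') q e = ⊕-cong (scale-congˡ q (at e 0)) (∷-cong refl (⊗-congˡ p p' q (∷-tail e)))

  ⊗-congʳ : ∀ p {q q'} → q ≋ q' → (p ⊗ q) ≋ (p ⊗ q')
  ⊗-congʳ []      e = ≋-refl
  ⊗-congʳ (a ∷ p) e = ⊕-cong (scale-congʳ a e) (∷-cong refl (⊗-congʳ p e))

  ⊗-distribʳ : ∀ q p p' → ((p ⊕ p') ⊗ q) ≋ ((p ⊗ q) ⊕ (p' ⊗ q))
  ⊗-distribʳ q []      p'       = ≋-refl
  ⊗-distribʳ q (a ∷ p) []       = ≋-sym (⊕-identityʳ ((a ∷ p) ⊗ q))
  ⊗-distribʳ q (a ∷ p) (b ∷ p') = begin
    scale (a + b) q ⊕ (0# ∷ (p ⊕ p') ⊗ q)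
      ≈⟨ ⊕-cong (scale-+ a b q) (∷-cong (sym (+-identityʳ 0#)) (⊗-distribʳ q p p')) ⟩
    (scale a q ⊕ scale b q) ⊕ ((0# ∷ p ⊗ q) ⊕ (0# ∷ p' ⊗ q))
      ≈⟨ ⊕-interchange (scale a q) (scale b q) _ _ ⟩
    (scale a q ⊕ (0# ∷ p ⊗ q)) ⊕ (scale b q ⊕ (0# ∷ p' ⊗ q))
      ∎
    where open ≋-Reasoning

  ⊗-distribˡ : ∀ p q q' → (p ⊗ (q ⊕ q')) ≋ ((p ⊗ q) ⊕ (p ⊗ q'))
  ⊗-distribˡ []      q q' = ≋-refl
  ⊗-distribˡ (a ∷ p) q q' = begin
    scale a (q ⊕ q') ⊕ (0# ∷ p ⊗ (q ⊕ q'))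
      ≈⟨ ⊕-cong (scale-⊕ a q q') (∷-cong (sym (+-identityʳ 0#)) (⊗-distribˡ p q q')) ⟩
    (scale a q ⊕ scale a q') ⊕ ((0# ∷ p ⊗ q) ⊕ (0# ∷ p ⊗ q'))
      ≈⟨ ⊕-interchange (scale a q) (scale a q') _ _ ⟩
    (scale a q ⊕ (0# ∷ p ⊗ q)) ⊕ (scale a q' ⊕ (0# ∷ p ⊗ q'))
      ∎
    where open ≋-Reasoning

  shift-⊗ : ∀ p q → ((0# ∷ p) ⊗ q) ≋ (0# ∷ (p ⊗ q))
  shift-⊗ p q = ⊕-cong (scale-0# q) ≋-refl

  scale-⊗ : ∀ a p q → (scale a p ⊗ q) ≋ scale a (p ⊗ q)
  scale-⊗ a []      q = ≋-refl
  scale-⊗ a (b ∷ p) q = begin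
    scale (a * b) q ⊕ (0# ∷ scale a p ⊗ q)
      ≈⟨ ⊕-cong (≋-sym (scale-* a b q)) (∷-cong (sym (zeroʳ a)) (scale-⊗ a p q)) ⟩
    scale a (scale b q) ⊕ scale a (0# ∷ p ⊗ q)
      ≈⟨ scale-⊕ a (scale b q) (0# ∷ p ⊗ q) ⟨
    scale a (scale b q ⊕ (0# ∷ p ⊗ q))
      ∎
    where open ≋-Reasoning

  ⊗-assoc : ∀ p q r → ((p ⊗ q) ⊗ r) ≋ (p ⊗ (q ⊗ r))
  ⊗-assoc []      q r = ≋-refl
  ⊗-assoc (a ∷ p) q r = begin
    (scale a q ⊕ (0# ∷ p ⊗ q)) ⊗ r           ≈⟨ ⊗-distribʳ r (scale a q) (0# ∷ p ⊗ q) ⟩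
    (scale a q ⊗ r) ⊕ ((0# ∷ p ⊗ q) ⊗ r)     ≈⟨ ⊕-cong (scale-⊗ a q r) (shift-⊗ (p ⊗ q) r) ⟩
    scale a (q ⊗ r) ⊕ (0# ∷ (p ⊗ q) ⊗ r)     ≈⟨ ⊕-cong ≋-refl (∷-cong refl (⊗-assoc p q r)) ⟩
    scale a (q ⊗ r) ⊕ (0# ∷ p ⊗ (q ⊗ r))     ∎
    where open ≋-Reasoning

  ⊗-identityˡ : ∀ q → (1P ⊗ q) ≋ q
  ⊗-identityˡ q = ≋-trans (⊕-cong (scale-1# q) 0∷[]≋[]) (⊕-identityʳ q)

  ⊗-identityʳ : ∀ p → (p ⊗ 1P) ≋ p
  ⊗-identityʳ []      = ≋-refl
  ⊗-identityʳ (a ∷ p) = ∷-cong (trans (+-identityʳ _) (*-identityʳ a)) (⊗-identityʳ p)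

  polyRing : Ring c ℓ
  polyRing = record
    { Carrier = Poly ; _≈_ = _≋_ ; _+_ = _⊕_ ; _*_ = _⊗_ ; -_ = ⊖_ ; 0# = 0P ; 1# = 1P
    ; isRing = record
      { +-isAbelianGroup = ⊕-isAbelianGroup
      ; *-cong = λ {p} {p'} {q} {q'} p≋p' q≋q' →
          ≋-trans (⊗-congˡ p p' q p≋p') (⊗-congʳ p' q≋q')
      ; *-assoc = ⊗-assoc
      ; *-identity = ⊗-identityˡ , ⊗-identityʳ
      ; distrib = ⊗-distribˡ , ⊗-distribʳ } }

  coeff-sumP : ∀ ps k → coeff (sumP ps) k ≈ sumL (List.map (λ p → coeff p k) ps)
  coeff-sumP []       k = refl
  coeff-sumP (p ∷ ps) k = trans (coeff-⊕ p (sumP ps) k) (+-congˡ (coeff-sumP ps k))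

  coeff-mono-at : ∀ d a → coeff (mono d a) d ≡ a
  coeff-mono-at zero    a = ≡.refl
  coeff-mono-at (suc d) a = coeff-mono-at d a

  coeff-mono-other : ∀ d a i → i ≢ d → coeff (mono d a) i ≡ 0#
  coeff-mono-other zero    a zero    i≢d = ⊥-elim (i≢d ≡.refl)
  coeff-mono-other zero    a (suc i) i≢d = ≡.refl
  coeff-mono-other (suc d) a zero    i≢d = ≡.refl
  coeff-mono-other (suc d) a (suc i) i≢d = coeff-mono-other d a i (λ i≡d → i≢d (≡.cong suc i≡d))

  mono-+ : ∀ d a b → mono d (a + b) ≋ (mono d a ⊕ mono d b)
  mono-+ zero    a b = ≋-refl
  mono-+ (suc d) a b = ∷-cong (sym (+-identityʳ 0#)) (mono-+ d a b)

  mono-≈0 : ∀ d {a} → a ≈ 0# → mono d a ≋ []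
  mono-≈0 zero    a≈0 = coeffwise λ { zero → a≈0 ; (suc k) → refl }
  mono-≈0 (suc d) a≈0 = ≋-trans (∷-cong refl (mono-≈0 d a≈0)) 0∷[]≋[]

module Filtration {c ℓ} (R : CommutativeRing c ℓ) where
  import Relation.Binary.Reasoning.Setoid
  open CommutativeRing R using ()
    renaming (Carrier to A; _≈_ to _≈ᴬ_; _+_ to _+ᴬ_; 0# to 0ᴬ)
  open import Data.Nat.Properties using (+-suc)
  open import Relation.Binary.PropositionalEquality as ≡ using (subst)
  open import Data.Product using (_×_; _,_)
  open import Data.Vec using ([]; _∷_)
  open import Data.Fin.Subset using (Subset; inside; outside; ∣_∣)
  import Algebra.Construct.Pointwise as Pointwise
  module ᴬ = CommutativeRing R
  module ᴬ-Reasoning = Relation.Binary.Reasoning.Setoid ᴬ.setoid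
  module ΣA = ListSums ᴬ.+-commutativeMonoid
  open import Algebra.Properties.CommutativeSemigroup ᴬ.+-commutativeSemigroup
    using () renaming (interchange to ᴬ-interchange)

  record FilteredRing : Set (lsuc (c ⊔ ℓ)) where
    field
      ring : Ring c ℓ
    open Ring ring public
    field
      Order        : ℕ → Carrier → Set ℓ
      Order-resp   : ∀ {d x y} → x ≈ y → Order d x → Order d y
      Order-0#     : ∀ {d} → Order d 0#
      Order-1#     : Order 0 1#
      Order-+      : ∀ {d x y} → Order d x → Order d y → Order d (x + y)
      Order--      : ∀ {d x} → Order d x → Order d (- x)
      Order-*      : ∀ {d e x y} → Order d x → Order e y → Order (d ℕ+ e) (x * y)
      Order-weaken : ∀ {d x} → Order (suc d) x → Order d x
      coefficient        : ℕ → Carrier → A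
      coefficient-cong   : ∀ {d x y} → x ≈ y → coefficient d x ≈ᴬ coefficient d y
      coefficient-+      : ∀ {d} x y → coefficient d (x + y) ≈ᴬ coefficient d x +ᴬ coefficient d y
      coefficient-vanish : ∀ {d x} → Order (suc d) x → coefficient d x ≈ᴬ 0ᴬ

  module LeadingParts (S : FilteredRing) where
    open FilteredRing S
    open RingFacts ring

    record SameLead (d : ℕ) (x y : Carrier) : Set ℓ where
      field
        left       : Order d x
        right      : Order d y
        difference : Order (suc d) (x - y)

    sameLead-refl : ∀ {d x} → Order d x → SameLead d x x
    sameLead-refl ox = record
      { left = ox ; right = ox ; difference = Order-resp (sym (-‿inverseʳ _)) Order-0# }

    sameLead-resp : ∀ {d x x' y y'} → x ≈ x' → y ≈ y' → SameLead d x y → SameLead d x' y'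
    sameLead-resp x≈x' y≈y' s = record
      { left = Order-resp x≈x' left ; right = Order-resp y≈y' right
      ; difference = Order-resp (+-cong x≈x' (-‿cong y≈y')) difference }
      where open SameLead s

    sameLead-+ : ∀ {d x x' y y'} → SameLead d x x' → SameLead d y y' → SameLead d (x + y) (x' + y')
    sameLead-+ sx sy = record
      { left = Order-+ (left sx) (left sy) ; right = Order-+ (right sx) (right sy)
      ; difference = Order-resp (sym (sub-+ _ _ _ _)) (Order-+ (difference sx) (difference sy)) }
      where open SameLead

    sameLead-- : ∀ {d x y} → SameLead d x y → SameLead d (- x) (- y)
    sameLead-- s = record
      { left = Order-- left ; right = Order-- right
      ; difference = Order-resp (sym (sub-neg _ _)) (Order-- difference) }
      where open SameLead s

    sameLead-* : ∀ {d e x x' y y'} → SameLead d x x' → SameLead e y y' →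
                 SameLead (d ℕ+ e) (x * y) (x' * y')
    sameLead-* {d} {e} {x} {x'} {y} {y'} sx sy = record
      { left = Order-* (left sx) (left sy) ; right = Order-* (right sx) (right sy)
      ; difference = Order-resp (sym (sub-* _ _ _ _))
          (Order-+ (Order-* (difference sx) (left sy))
                   (subst (λ n → Order n (x' * (y - y'))) (+-suc d e) (Order-* (right sx) (difference sy)))) }
      where open SameLead

    sameLead⇒coefficient : ∀ {d x y} → SameLead d x y → coefficient d x ≈ᴬ coefficient d y
    sameLead⇒coefficient {d} {x} {y} s = begin
      coefficient d x                            ≈⟨ coefficient-cong (sub-add x y) ⟨
      coefficient d ((x - y) + y)                ≈⟨ coefficient-+ (x - y) y ⟩
      coefficient d (x - y) +ᴬ coefficient d y   ≈⟨ ᴬ.+-congʳ (coefficient-vanish (SameLead.difference s)) ⟩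
      0ᴬ +ᴬ coefficient d y                      ≈⟨ ᴬ.+-identityˡ _ ⟩
      coefficient d y                            ∎
      where open ᴬ-Reasoning

  module PolynomialFiltration where
    open Polynomials R
    open Construction R
    open import Data.Nat using (_<_; z≤n; s≤s)
    open import Data.Nat.Properties using (m<n⇒m<1+n; n<1+n; <⇒≢; <-≤-trans; m<1+n⇒m<n∨m≡n)
    open import Algebra.Properties.Ring ᴬ.ring using (-0#≈0#)

    Ord : ℕ → Poly → Set ℓ
    Ord d p = ∀ i → i < d → coeff p i ≈ᴬ 0ᴬ

    Ord-+ : ∀ {d} p q → Ord d p → Ord d q → Ord d (p ⊕ q)
    Ord-+ p q op oq i i<d = ᴬ.trans (coeff-⊕ p q i) (ᴬ.trans (ᴬ.+-cong (op i i<d) (oq i i<d)) (ᴬ.+-identityʳ 0ᴬ))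

    Ord-- : ∀ {d} p → Ord d p → Ord d (⊖ p)
    Ord-- p op i i<d = ᴬ.trans (coeff-⊖ p i) (ᴬ.trans (ᴬ.-‿cong (op i i<d)) -0#≈0#)

    Ord-shift : ∀ {d} p → Ord d p → Ord (suc d) (0ᴬ ∷ p)
    Ord-shift p op zero    _         = ᴬ.refl
    Ord-shift p op (suc i) (s≤s i<d) = op i i<d

    Ord-scale : ∀ {d} a p → Ord d p → Ord d (scale a p)
    Ord-scale a p op i i<d = ᴬ.trans (coeff-scale a p i) (ᴬ.trans (ᴬ.*-congˡ (op i i<d)) (ᴬ.zeroʳ a))

    Ord-≋[] : ∀ {d p} → p ≋ [] → Ord d p
    Ord-≋[] p≋[] i _ = at p≋[] i

    Ord-[] : ∀ {d} → Ord d []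
    Ord-[] i _ = ᴬ.refl

    Ord-mono : ∀ d a → Ord d (mono d a)
    Ord-mono d a i i<d = ᴬ.reflexive (coeff-mono-other d a i (<⇒≢ i<d))

    Ord-≤ : ∀ {d e} p → d ≤ e → Ord e p → Ord d p
    Ord-≤ p d≤e op i i<d = op i (<-≤-trans i<d d≤e)

    Ord-sumP : ∀ {X : Set} {d} (φ : X → Poly) l → (∀ x → Ord d (φ x)) → Ord d (sumP (List.map φ l))
    Ord-sumP φ []      oφ = Ord-[]
    Ord-sumP φ (x ∷ l) oφ = Ord-+ (φ x) _ (oφ x) (Ord-sumP φ l oφ)

    Ord-* : ∀ d {e} p q → Ord d p → Ord e q → Ord (d ℕ+ e) (p ⊗ q)
    Ord-* d       []      q op oq = Ord-[]
    Ord-* zero    (a ∷ p) q op oq =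
      Ord-+ (scale a q) (0ᴬ ∷ p ⊗ q) (Ord-scale a q oq)
            (λ i i<e → Ord-shift (p ⊗ q) (Ord-* zero p q (λ _ ()) oq) i (m<n⇒m<1+n i<e))
    Ord-* (suc d) (a ∷ p) q op oq =
      Ord-+ (scale a q) (0ᴬ ∷ p ⊗ q)
            (Ord-≋[] (≋-trans (scale-congˡ q (op 0 (s≤s z≤n))) (scale-0# q)))
            (Ord-shift (p ⊗ q) (Ord-* d p q (λ i i<d → op (suc i) (s≤s i<d)) oq))

    polyFiltered : FilteredRing
    polyFiltered = record
      { ring               = polyRing
      ; Order              = Ord
      ; Order-resp         = λ p≋q op i i<d → ᴬ.trans (ᴬ.sym (at p≋q i)) (op i i<d)
      ; Order-0#           = Ord-[]
      ; Order-1#           = λ i ()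
      ; Order-+            = λ {_} {p} {q} → Ord-+ p q
      ; Order--            = λ {_} {p} → Ord-- p
      ; Order-*            = λ {d} {_} {p} {q} → Ord-* d p q
      ; Order-weaken       = λ op i i<d → op i (m<n⇒m<1+n i<d)
      ; coefficient        = λ d p → coeff p d
      ; coefficient-cong   = λ {d} p≋q → at p≋q d
      ; coefficient-+      = λ {d} p q → coeff-⊕ p q d
      ; coefficient-vanish = λ {d} op → op d (n<1+n d) }

    open LeadingParts polyFiltered using (SameLead)

    sameLead-mono : ∀ {d a} p → Ord d p → coeff p d ≈ᴬ a → SameLead d p (mono d a)
    sameLead-mono {d} {a} p op p[d]≈a = record
      { left = op ; right = Ord-mono d a ; difference = difference }
      where
      difference : Ord (suc d) (p ⊕ (⊖ (mono d a)))
      difference i i<1+d with m<1+n⇒m<n∨m≡n i<1+d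
      ... | inj₁ i<d    = Ord-+ p (⊖ (mono d a)) op (Ord-- (mono d a) (Ord-mono d a)) i i<d
      ... | inj₂ ≡.refl = ᴬ.trans (coeff-⊕ p (⊖ (mono d a)) i)
          (ᴬ.trans (ᴬ.+-cong p[d]≈a (ᴬ.trans (coeff-⊖ (mono d a) i) (ᴬ.-‿cong (ᴬ.reflexive (coeff-mono-at d a)))))
                   (ᴬ.-‿inverseʳ a))

  module Characteristic2 (char2 : HasCharacteristic2 R) where
    open ᴬ-Reasoning

    double≈0 : ∀ a → a +ᴬ a ≈ᴬ 0ᴬ
    double≈0 a = begin
      a +ᴬ a                    ≈⟨ ᴬ.+-cong (ᴬ.*-identityˡ a) (ᴬ.*-identityˡ a) ⟨
      ᴬ.1# ᴬ.* a +ᴬ ᴬ.1# ᴬ.* a  ≈⟨ ᴬ.distribʳ a ᴬ.1# ᴬ.1# ⟨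
      (ᴬ.1# +ᴬ ᴬ.1#) ᴬ.* a      ≈⟨ ᴬ.*-congʳ char2 ⟩
      0ᴬ ᴬ.* a                  ≈⟨ ᴬ.zeroˡ a ⟩
      0ᴬ                        ∎

    add-twice : ∀ a b → (a +ᴬ b) +ᴬ b ≈ᴬ a
    add-twice a b = begin
      (a +ᴬ b) +ᴬ b  ≈⟨ ᴬ.+-assoc a b b ⟩
      a +ᴬ (b +ᴬ b)  ≈⟨ ᴬ.+-congˡ (double≈0 b) ⟩
      a +ᴬ 0ᴬ        ≈⟨ ᴬ.+-identityʳ a ⟩
      a              ∎

  -- Iterating, F ↦ (lo, Δ) computes the Möbius transform μF; we filter families by
  -- "μF(Z) has order d + |Z| for every Z", which is Order↑ below.
  module Lifting (char2 : HasCharacteristic2 R) (S : FilteredRing) where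
    open FilteredRing S
    open Characteristic2 char2
    open RingFacts ring

    Family : ℕ → Set c
    Family k = Subset k → Carrier

    lo hi Δ : ∀ {k} → Family (suc k) → Family k
    lo F Y = F (outside ∷ Y)
    hi F Y = F (inside ∷ Y)
    Δ F Y = hi F Y - lo F Y

    Order↑ : ∀ k → ℕ → Family k → Set ℓ
    Order↑ zero    d F = Order d (F [])
    Order↑ (suc k) d F = Order↑ k d (lo F) × Order↑ k (suc d) (Δ F)

    Order↑-resp : ∀ k {d F G} → (∀ Y → F Y ≈ G Y) → Order↑ k d F → Order↑ k d G
    Order↑-resp zero    F≈G o          = Order-resp (F≈G []) o
    Order↑-resp (suc k) F≈G (oL , oΔ) =
      Order↑-resp k (λ Y → F≈G (outside ∷ Y)) oL ,
      Order↑-resp k (λ Y → +-cong (F≈G (inside ∷ Y)) (-‿cong (F≈G (outside ∷ Y)))) oΔ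

    Order↑-0# : ∀ k {d} → Order↑ k d (λ _ → 0#)
    Order↑-0# zero    = Order-0#
    Order↑-0# (suc k) = Order↑-0# k , Order↑-resp k (λ _ → sym (-‿inverseʳ 0#)) (Order↑-0# k)

    Order↑-1# : ∀ k → Order↑ k 0 (λ _ → 1#)
    Order↑-1# zero    = Order-1#
    Order↑-1# (suc k) = Order↑-1# k , Order↑-resp k (λ _ → sym (-‿inverseʳ 1#)) (Order↑-0# k)

    Order↑-+ : ∀ k {d F G} → Order↑ k d F → Order↑ k d G → Order↑ k d (λ Y → F Y + G Y)
    Order↑-+ zero    oF oG = Order-+ oF oG
    Order↑-+ (suc k) (oFL , oFΔ) (oGL , oGΔ) =
      Order↑-+ k oFL oGL ,
      Order↑-resp k (λ Y → sym (sub-+ _ _ _ _)) (Order↑-+ k oFΔ oGΔ)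

    Order↑-- : ∀ k {d F} → Order↑ k d F → Order↑ k d (λ Y → - F Y)
    Order↑-- zero    o          = Order-- o
    Order↑-- (suc k) (oL , oΔ) =
      Order↑-- k oL , Order↑-resp k (λ Y → sym (sub-neg _ _)) (Order↑-- k oΔ)

    Order↑-weaken : ∀ k {d F} → Order↑ k (suc d) F → Order↑ k d F
    Order↑-weaken zero    o          = Order-weaken o
    Order↑-weaken (suc k) (oL , oΔ) = Order↑-weaken k oL , Order↑-weaken k oΔ

    -- the upper half hi F = Δ F + lo F is as small as F itself
    Order↑-hi : ∀ k {d} F → Order↑ (suc k) d F → Order↑ k d (hi F)
    Order↑-hi k F (oL , oΔ) =
      Order↑-resp k (λ Y → sub-add (hi F Y) (lo F Y)) (Order↑-+ k (Order↑-weaken k oΔ) oL)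

    -- Δ(F·G) = Δ F · hi G + lo F · Δ G  gives multiplicativity of the filtration
    Order↑-* : ∀ k {d e} F G → Order↑ k d F → Order↑ k e G → Order↑ k (d ℕ+ e) (λ Y → F Y * G Y)
    Order↑-* zero    F G oF oG = Order-* oF oG
    Order↑-* (suc k) {d} {e} F G (oFL , oFΔ) oG@(oGL , oGΔ) =
      Order↑-* k (lo F) (lo G) oFL oGL ,
      Order↑-resp k (λ Y → sym (sub-* _ _ _ _))
        (Order↑-+ k (Order↑-* k (Δ F) (hi G) oFΔ (Order↑-hi k G oG))
                    (subst (λ n → Order↑ k n (λ Y → lo F Y * Δ G Y)) (+-suc d e)
                           (Order↑-* k (lo F) (Δ G) oFL oGΔ)))

    ζ : ∀ k → Family k → Family k
    ζ zero    G Y             = G Y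
    ζ (suc k) G (outside ∷ Y) = ζ k (lo G) Y
    ζ (suc k) G (inside ∷ Y)  = ζ k (hi G) Y + ζ k (lo G) Y

    -- μ(ζ G) = G, so ζ G has order d as soon as each G Z has order |Z| + d
    ζ-Order : ∀ k {d} G → (∀ Z → Order (∣ Z ∣ ℕ+ d) (G Z)) → Order↑ k d (ζ k G)
    ζ-Order zero    G oG = oG []
    ζ-Order (suc k) {d} G oG =
      ζ-Order k (lo G) (λ Z → oG (outside ∷ Z)) ,
      Order↑-resp k (λ Y → sym (add-sub (ζ k (hi G) Y) (ζ k (lo G) Y)))
        (ζ-Order k (hi G) (λ Z → subst (λ n → Order n (hi G Z)) (≡.sym (+-suc ∣ Z ∣ d)) (oG (inside ∷ Z))))

    ζ-- : ∀ k G G' Y → ζ k (λ Z → G Z - G' Z) Y ≈ ζ k G Y - ζ k G' Y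
    ζ-- zero    G G' Y             = refl
    ζ-- (suc k) G G' (outside ∷ Y) = ζ-- k (lo G) (lo G') Y
    ζ-- (suc k) G G' (inside ∷ Y)  =
      trans (+-cong (ζ-- k (hi G) (hi G') Y) (ζ-- k (lo G) (lo G') Y)) (sym (sub-+ _ _ _ _))

    coefficient↑ : ∀ k → ℕ → Family k → A
    coefficient↑ zero    d F = coefficient d (F [])
    coefficient↑ (suc k) d F = coefficient↑ k d (hi F) +ᴬ coefficient↑ k d (lo F)

    coefficient↑-cong : ∀ k {d F G} → (∀ Y → F Y ≈ G Y) → coefficient↑ k d F ≈ᴬ coefficient↑ k d G
    coefficient↑-cong zero    F≈G = coefficient-cong (F≈G [])
    coefficient↑-cong (suc k) F≈G =
      ᴬ.+-cong (coefficient↑-cong k (λ Y → F≈G (inside ∷ Y))) (coefficient↑-cong k (λ Y → F≈G (outside ∷ Y)))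

    coefficient↑-+ : ∀ k {d} F G →
                     coefficient↑ k d (λ Y → F Y + G Y) ≈ᴬ coefficient↑ k d F +ᴬ coefficient↑ k d G
    coefficient↑-+ zero    F G = coefficient-+ (F []) (G [])
    coefficient↑-+ (suc k) F G =
      ᴬ.trans (ᴬ.+-cong (coefficient↑-+ k (hi F) (hi G)) (coefficient↑-+ k (lo F) (lo G)))
              (ᴬ-interchange _ _ _ _)

    coefficient↑-sum : ∀ k d F → coefficient↑ k d F ≈ᴬ ΣA.sum (List.map (λ Y → coefficient d (F Y)) (allSubsets k))
    coefficient↑-sum zero    d F = ᴬ.sym (ᴬ.+-identityʳ _)
    coefficient↑-sum (suc k) d F =
      ᴬ.trans (ᴬ.+-cong (coefficient↑-sum k d (hi F)) (coefficient↑-sum k d (lo F)))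
              (ᴬ.sym (ΣA.sum-subsets k (λ Y → coefficient d (F Y))))

    -- In characteristic 2, Σ_Y F(Y) = Σ_Y Δ F(Y): the total coefficient only sees μF at the
    -- full set, whose order exceeds k + d when F has order d + 1.
    coefficient↑-vanish : ∀ k {d} F → Order↑ k (suc d) F → coefficient↑ k (k ℕ+ d) F ≈ᴬ 0ᴬ
    coefficient↑-vanish zero    F o = coefficient-vanish o
    coefficient↑-vanish (suc k) {d} F (oL , oΔ) = begin
      κ (hi F) +ᴬ κ (lo F)                  ≈⟨ ᴬ.+-congʳ (coefficient↑-cong k (λ Y → sym (sub-add (hi F Y) (lo F Y)))) ⟩
      κ (λ Y → Δ F Y + lo F Y) +ᴬ κ (lo F)  ≈⟨ ᴬ.+-congʳ (coefficient↑-+ k (Δ F) (lo F)) ⟩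
      (κ (Δ F) +ᴬ κ (lo F)) +ᴬ κ (lo F)     ≈⟨ add-twice (κ (Δ F)) (κ (lo F)) ⟩
      κ (Δ F)                               ≈⟨ subst (λ n → coefficient↑ k n (Δ F) ≈ᴬ 0ᴬ) (+-suc k d)
                                                     (coefficient↑-vanish k (Δ F) oΔ) ⟩
      0ᴬ                                    ∎
      where
      open ᴬ-Reasoning
      κ : Family k → A
      κ = coefficient↑ k (suc (k ℕ+ d))

    lifted : ℕ → FilteredRing
    lifted k = record
      { ring               = Pointwise.ring (Subset k) ring
      ; Order              = Order↑ k
      ; Order-resp         = Order↑-resp k
      ; Order-0#           = Order↑-0# k
      ; Order-1#           = Order↑-1# k
      ; Order-+            = Order↑-+ k
      ; Order--            = Order↑-- k
      ; Order-*            = λ {_} {_} {F} {G} → Order↑-* k F G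
      ; Order-weaken       = Order↑-weaken k
      ; coefficient        = λ d → coefficient↑ k (k ℕ+ d)
      ; coefficient-cong   = coefficient↑-cong k
      ; coefficient-+      = coefficient↑-+ k
      ; coefficient-vanish = λ {_} {F} → coefficient↑-vanish k F }

    open LeadingParts using (SameLead)

    ζ-sameLead : ∀ k {d} G G' → (∀ Z → SameLead S (∣ Z ∣ ℕ+ d) (G Z) (G' Z)) →
                 SameLead (lifted k) d (ζ k G) (ζ k G')
    ζ-sameLead k {d} G G' s = record
      { left       = ζ-Order k G (λ Z → left (s Z))
      ; right      = ζ-Order k G' (λ Z → right (s Z))
      ; difference = Order↑-resp k (ζ-- k G G')
          (ζ-Order k (λ Z → G Z - G' Z)
            (λ Z → subst (λ n → Order n (G Z - G' Z)) (≡.sym (+-suc ∣ Z ∣ d)) (difference (s Z)))) }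
      where open LeadingParts.SameLead

module Lemma8Proof {c ℓ} (R : CommutativeRing c ℓ) (char2 : HasCharacteristic2 R)
                   (h m : ℕ)
                   (adj : Fin h ⊎ Fin h → Fin h ⊎ Fin h → Bool)
                   (xE : Fin h ⊎ Fin h → Fin h ⊎ Fin h → CommutativeRing.Carrier R)
                   (xL : Fin h → Fin h → Fin m → CommutativeRing.Carrier R) where
  open CommutativeRing R using (_≈_; 0#; refl; sym; trans; reflexive)
  open import Data.Bool using (T; if_then_else_; _∧_; not)
  open import Data.Bool.Properties using (∧-conicalˡ; ∧-conicalʳ)
  open import Data.Nat using (_≤ᵇ_; s≤s)
  open import Data.Nat.Properties using (≤ᵇ⇒≤; ≤⇒≤ᵇ; ≤-refl; ≤-trans; m≤m+n)
    renaming (+-identityʳ to +-identityʳℕ; +-comm to +-commℕ)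
  open import Data.Fin.Subset using (Subset; ⁅_⁆; ∣_∣; inside; outside)
  open import Data.Fin.Subset.Properties using (∣⁅x⁆∣≡1; ∣p∣≤n)
  open import Data.Vec using ([]; _∷_)
  open import Data.Empty using (⊥-elim)
  open import Data.List.Properties using (map-∘; map-upTo)
  import Relation.Binary.PropositionalEquality as ≡
  open Construction R
  open Setting h m adj xE xL
  open Polynomials R
  open Filtration R
  open PolynomialFiltration
  open Supports
  module ΣP = ListSums (Ring.+-commutativeMonoid polyRing)
  module P = LeadingParts polyFiltered
  open P using (SameLead)

  walkTerm : Fin h → Fin h → Subset h → ℕ → Poly
  walkTerm u v X k = if ∣ X ∣ ≤ᵇ k then mono k (walkSum u v X k) else 0P

  walkPoly : Fin h → Fin h → Subset h → Poly
  walkPoly u v X = sumP (List.map (walkTerm u v X) (List.upTo (suc n)))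

  walkTerm-Ord : ∀ u v X k → Ord ∣ X ∣ (walkTerm u v X k)
  walkTerm-Ord u v X k with ∣ X ∣ ≤ᵇ k in le
  ... | true  = Ord-≤ (mono k (walkSum u v X k)) (≤ᵇ⇒≤ ∣ X ∣ k (≡.subst T (≡.sym le) _)) (Ord-mono k _)
  ... | false = Ord-[]

  walkTerm-at : ∀ u v X → coeff (walkTerm u v X ∣ X ∣) ∣ X ∣ ≡ walkSum u v X ∣ X ∣
  walkTerm-at u v X with ∣ X ∣ ≤ᵇ ∣ X ∣ in le
  ... | true  = coeff-mono-at ∣ X ∣ _
  ... | false = ⊥-elim (≡.subst T le (≤⇒≤ᵇ (≤-refl {∣ X ∣})))

  walkTerm-other : ∀ u v X k → k ≢ ∣ X ∣ → coeff (walkTerm u v X k) ∣ X ∣ ≈ 0#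
  walkTerm-other u v X k k≢ with ∣ X ∣ ≤ᵇ k
  ... | true  = reflexive (coeff-mono-other k _ ∣ X ∣ (λ e → k≢ (≡.sym e)))
  ... | false = refl

  -- the walk part has order |X|, and its leading coefficient counts walks of length |X|+1,
  -- which by the pigeonhole principle are exactly the paths through X
  walkPoly-Ord : ∀ u v X → Ord ∣ X ∣ (walkPoly u v X)
  walkPoly-Ord u v X = Ord-sumP (walkTerm u v X) (List.upTo (suc n)) (walkTerm-Ord u v X)

  walkPoly-lead : ∀ u v X → coeff (walkPoly u v X) ∣ X ∣ ≈ walkSum u v X ∣ X ∣
  walkPoly-lead u v X = begin
    coeff (walkPoly u v X) ∣ X ∣
      ≈⟨ coeff-sumP (List.map (walkTerm u v X) (List.upTo (suc n))) ∣ X ∣ ⟩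
    sumL (List.map (λ p → coeff p ∣ X ∣) (List.map (walkTerm u v X) (List.upTo (suc n))))
      ≡⟨ ≡.cong sumL (≡.trans (≡.sym (map-∘ (List.upTo (suc n)))) (map-upTo _ (suc n))) ⟩
    sumL (List.applyUpTo (λ k → coeff (walkTerm u v X k) ∣ X ∣) (suc n))
      ≈⟨ ΣA.sum-single _ (suc n) ∣ X ∣ (s≤s (≤-trans (∣p∣≤n X) (m≤m+n h h))) (walkTerm-other u v X) ⟩
    coeff (walkTerm u v X ∣ X ∣) ∣ X ∣
      ≡⟨ walkTerm-at u v X ⟩
    walkSum u v X ∣ X ∣
      ∎
    where open ᴬ-Reasoning

  walkSum-paths : ∀ u v X → walkSum u v X ∣ X ∣ ≈ pathSum u v X
  walkSum-paths u v X = ΣA.sum-cong (allVecs h ∣ X ∣) λ ws →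
    reflexive (≡.cong (λ b → when b (prodArcs (seqOf u ws v)))
      (implied-∧ (distinct ws) (support ws ==S X) (isWalk (seqOf u ws v))
        (λ spans → pigeonhole ws (≡.cong ∣_∣ (==S-sound (support ws) X spans)))))
    where
    implied-∧ : ∀ a b w → (b ≡ true → a ≡ true) → b ∧ w ≡ a ∧ (b ∧ w)
    implied-∧ true  b     w _   = ≡.refl
    implied-∧ false true  w b⇒a with b⇒a ≡.refl
    ... | ()
    implied-∧ false false w _   = ≡.refl

  labelTerm-degree : ∀ u v Z₂ Zₘ → (∣ Z₂ ∣ ℕ+ ∣ Zₘ ∣ ≡ 1) ⊎ (labelTerm u v Z₂ Zₘ ≈ 0#)
  labelTerm-degree u v Z₂ Zₘ = ΣA.sum-or-zero (List.allFin m) λ d →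
    when-or _ (xL u v d) λ holds →
      ≡.cong₂ _ℕ+_ (empty-card Z₂ (∧-conicalˡ _ _ holds))
        (≡.trans (≡.cong ∣_∣ (==S-sound Zₘ ⁅ d ⁆ (∧-conicalˡ _ _ (∧-conicalʳ (isEmptyS Z₂) _ holds))))
                 (∣⁅x⁆∣≡1 d))
    where
    when-or : ∀ {P : Set} b a → (b ≡ true → P) → P ⊎ (when b a ≈ 0#)
    when-or true  a b⇒P = inj₁ (b⇒P ≡.refl)
    when-or false a b⇒P = inj₂ refl

  gEntry fEntry : Fin h → Fin h → Subset h → Subset m → Poly
  gEntry i j Z₂ Zₘ = offDiag i j (g i j Z₂ Zₘ)
  fEntry i j Z₂ Zₘ = offDiag i j (mono (∣ Z₂ ∣ ℕ+ ∣ Zₘ ∣) (f i j Z₂ Zₘ))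

  entry-sameLead : ∀ i j Z₂ Zₘ → SameLead (∣ Z₂ ∣ ℕ+ ∣ Zₘ ∣) (gEntry i j Z₂ Zₘ) (fEntry i j Z₂ Zₘ)
  entry-sameLead i j Z₂ Zₘ =
    offDiag-sameLead (P.sameLead-resp ≋-refl (≋-sym (mono-+ D _ _))
      (P.sameLead-+ (walkPart (isEmptyS Zₘ ∧ not (isEmptyS Z₂)) λ c → empty-card Zₘ (∧-conicalˡ _ _ c))
                    labelPart))
    where
    D = ∣ Z₂ ∣ ℕ+ ∣ Zₘ ∣

    offDiag-sameLead : ∀ {p q} → SameLead D p q → SameLead D (offDiag i j p) (offDiag i j q)
    offDiag-sameLead s with i ==F j
    ... | true  = P.sameLead-refl Ord-[]
    ... | false = s

    walkPart : ∀ b → (b ≡ true → ∣ Zₘ ∣ ≡ 0) →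
               SameLead D (if b then walkPoly i j Z₂ else 0P) (mono D (when b (pathSum i j Z₂)))
    walkPart true  noLabels = ≡.subst (λ e → SameLead e (walkPoly i j Z₂) (mono e (pathSum i j Z₂)))
      (≡.sym (≡.trans (≡.cong (∣ Z₂ ∣ ℕ+_) (noLabels ≡.refl)) (+-identityʳℕ ∣ Z₂ ∣)))
      (sameLead-mono (walkPoly i j Z₂) (walkPoly-Ord i j Z₂) (trans (walkPoly-lead i j Z₂) (walkSum-paths i j Z₂)))
    walkPart false _        = P.sameLead-resp ≋-refl (≋-sym (mono-≈0 D refl)) (P.sameLead-refl Ord-[])

    label = labelTerm i j Z₂ Zₘ

    labelPart : SameLead D (mono 1 label) (mono D label)
    labelPart with labelTerm-degree i j Z₂ Zₘ
    ... | inj₁ D≡1     = ≡.subst (λ e → SameLead e (mono 1 label) (mono e label)) (≡.sym D≡1)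
                                 (P.sameLead-refl (Ord-mono 1 label))
    ... | inj₂ label≈0 = P.sameLead-resp (≋-sym (mono-≈0 1 label≈0)) (≋-sym (mono-≈0 D label≈0))
                                         (P.sameLead-refl Ord-[])

  module L₀ = Lifting char2 polyFiltered
  S₁ : FilteredRing
  S₁ = L₀.lifted m
  module L₁ = Lifting char2 S₁
  S₂ : FilteredRing
  S₂ = L₁.lifted h
  module S₂ = FilteredRing S₂
  module F₂ = LeadingParts S₂

  Fam₂ : Set c
  Fam₂ = Subset h → Subset m → Poly

  ζ-eval : ∀ k (H : Subset k → Subset m → Poly) Y Yₘ → L₁.ζ k H Y Yₘ ≡ L₀.ζ k (λ Z → H Z Yₘ) Y
  ζ-eval zero    H []            Yₘ = ≡.refl
  ζ-eval (suc k) H (outside ∷ Y) Yₘ = ζ-eval k (λ Z → H (outside ∷ Z)) Y Yₘ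
  ζ-eval (suc k) H (inside ∷ Y)  Yₘ =
    ≡.cong₂ _⊕_ (ζ-eval k (λ Z → H (inside ∷ Z)) Y Yₘ) (ζ-eval k (λ Z → H (outside ∷ Z)) Y Yₘ)

  subsetSum : ∀ k → (Subset k → Poly) → Subset k → Poly
  subsetSum k H Y = sumP (List.map (λ Z → if Z ⊆B Y then H Z else 0P) (allSubsets k))

  ζ-subsetSum : ∀ k H Y → L₀.ζ k H Y ≋ subsetSum k H Y
  ζ-subsetSum zero    H []            = ≋-sym (⊕-identityʳ (H []))
  ζ-subsetSum (suc k) H (inside ∷ Y)  =
    ≋-trans (⊕-cong (ζ-subsetSum k (λ Z → H (inside ∷ Z)) Y) (ζ-subsetSum k (λ Z → H (outside ∷ Z)) Y))
            (≋-sym (ΣP.sum-subsets k (λ Z → if Z ⊆B (inside ∷ Y) then H Z else 0P)))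
  ζ-subsetSum (suc k) H (outside ∷ Y) =
    ≋-trans (ζ-subsetSum k (λ Z → H (outside ∷ Z)) Y)
    (≋-trans (⊕-cong (≋-sym (ΣP.sum-zero (allSubsets k) (λ _ → ≋-refl))) ≋-refl)
             (≋-sym (ΣP.sum-subsets k (λ Z → if Z ⊆B (outside ∷ Y) then H Z else 0P))))

  subsetSum-cong : ∀ k H H' Y → (∀ Z → H Z ≋ H' Z) → subsetSum k H Y ≋ subsetSum k H' Y
  subsetSum-cong k H H' Y H≋H' = ΣP.sum-cong (allSubsets k) λ Z → if-cong Z (Z ⊆B Y)
    where
    if-cong : ∀ Z b → (if b then H Z else 0P) ≋ (if b then H' Z else 0P)
    if-cong Z true  = H≋H' Z
    if-cong Z false = ≋-refl

  sumSub-ζ : ∀ (G : Subset h → Subset m → Poly) Y₂ Yₘ → sumSub Y₂ Yₘ G ≋ L₁.ζ h (λ Z₂ → L₀.ζ m (G Z₂)) Y₂ Yₘ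
  sumSub-ζ G Y₂ Yₘ = begin
    sumSub Y₂ Yₘ G
      ≈⟨ ΣP.sum-concat (λ Z₂ → List.map (term Z₂) (allSubsets m)) (allSubsets h) ⟩
    sumP (List.map (λ Z₂ → sumP (List.map (term Z₂) (allSubsets m))) (allSubsets h))
      ≈⟨ ΣP.sum-cong (allSubsets h) (λ Z₂ → restrict (Z₂ ⊆B Y₂) (G Z₂)) ⟩
    subsetSum h (λ Z₂ → subsetSum m (G Z₂) Yₘ) Y₂
      ≈⟨ subsetSum-cong h _ _ Y₂ (λ Z₂ → ≋-sym (ζ-subsetSum m (G Z₂) Yₘ)) ⟩
    subsetSum h (λ Z₂ → L₀.ζ m (G Z₂) Yₘ) Y₂
      ≈⟨ ζ-subsetSum h _ Y₂ ⟨
    L₀.ζ h (λ Z₂ → L₀.ζ m (G Z₂) Yₘ) Y₂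
      ≡⟨ ζ-eval h (λ Z₂ → L₀.ζ m (G Z₂)) Y₂ Yₘ ⟨
    L₁.ζ h (λ Z₂ → L₀.ζ m (G Z₂)) Y₂ Yₘ
      ∎
    where
    open ≋-Reasoning
    term : Subset h → Subset m → Poly
    term Z₂ Zₘ = if (Z₂ ⊆B Y₂) ∧ (Zₘ ⊆B Yₘ) then G Z₂ Zₘ else 0P
    restrict : ∀ b H → sumP (List.map (λ Zₘ → if b ∧ (Zₘ ⊆B Yₘ) then H Zₘ else 0P) (allSubsets m))
                       ≋ (if b then subsetSum m H Yₘ else 0P)
    restrict true  H = ≋-refl
    restrict false H = ΣP.sum-zero (allSubsets m) (λ _ → ≋-refl)

  Mq Mp : Fin h → Fin h → Fam₂
  Mq i j Y₂ Yₘ = sumSub Y₂ Yₘ (gEntry i j)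
  Mp i j Y₂ Yₘ = sumSub Y₂ Yₘ (fEntry i j)

  matrix-sameLead : ∀ i j → F₂.SameLead 0 (Mq i j) (Mp i j)
  matrix-sameLead i j =
    F₂.sameLead-resp (λ Y₂ Yₘ → ≋-sym (sumSub-ζ (gEntry i j) Y₂ Yₘ)) (λ Y₂ Yₘ → ≋-sym (sumSub-ζ (fEntry i j) Y₂ Yₘ))
      (L₁.ζ-sameLead h _ _ λ Z₂ → L₀.ζ-sameLead m (gEntry i j Z₂) (fEntry i j Z₂) λ Zₘ →
        ≡.subst (λ d → SameLead d (gEntry i j Z₂ Zₘ) (fEntry i j Z₂ Zₘ)) (reindex Z₂ Zₘ) (entry-sameLead i j Z₂ Zₘ))
    where
    reindex : ∀ (Z₂ : Subset h) (Zₘ : Subset m) → ∣ Z₂ ∣ ℕ+ ∣ Zₘ ∣ ≡ ∣ Zₘ ∣ ℕ+ (∣ Z₂ ∣ ℕ+ 0)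
    reindex Z₂ Zₘ = ≡.trans (+-commℕ ∣ Z₂ ∣ ∣ Zₘ ∣) (≡.cong (∣ Zₘ ∣ ℕ+_) (≡.sym (+-identityʳℕ ∣ Z₂ ∣)))

  -- Determinants, computed pointwise in Y, preserve "same leading part in degree 0":
  -- the Laplace expansion only uses sums, signs and products.
  detFam : ∀ k → (Fin k → Fin k → Fam₂) → Fam₂
  detFam k M Y₂ Yₘ = det k (λ i j → M i j Y₂ Yₘ)

  sumP-sameLead : ∀ {X : Set} (t t' : X → Fam₂) l → (∀ x → F₂.SameLead 0 (t x) (t' x)) →
    F₂.SameLead 0 (λ Y₂ Yₘ → sumP (List.map (λ x → t x Y₂ Yₘ) l)) (λ Y₂ Yₘ → sumP (List.map (λ x → t' x Y₂ Yₘ) l))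
  sumP-sameLead t t' []      s = F₂.sameLead-refl S₂.Order-0#
  sumP-sameLead t t' (x ∷ l) s = F₂.sameLead-+ (s x) (sumP-sameLead t t' l s)

  signed-sameLead : ∀ k (F F' : Fam₂) → F₂.SameLead 0 F F' →
    F₂.SameLead 0 (λ Y₂ Yₘ → signed k (F Y₂ Yₘ)) (λ Y₂ Yₘ → signed k (F' Y₂ Yₘ))
  signed-sameLead zero    F F' s = s
  signed-sameLead (suc k) F F' s = F₂.sameLead-- (signed-sameLead k F F' s)

  det-sameLead : ∀ k (M M' : Fin k → Fin k → Fam₂) → (∀ i j → F₂.SameLead 0 (M i j) (M' i j)) →
                 F₂.SameLead 0 (detFam k M) (detFam k M')
  det-sameLead zero    M M' s = F₂.sameLead-refl S₂.Order-1#
  det-sameLead (suc k) M M' s =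
    sumP-sameLead (expansionTerm M) (expansionTerm M') (List.allFin (suc k)) λ j →
      signed-sameLead (toℕ j) _ _
        (F₂.sameLead-* (s zero j) (det-sameLead k (minor M j) (minor M' j) (λ a b → s (suc a) (punchIn j b))))
    where
    minor : (Fin (suc k) → Fin (suc k) → Fam₂) → Fin (suc k) → Fin k → Fin k → Fam₂
    minor N j a b = N (suc a) (punchIn j b)
    expansionTerm : (Fin (suc k) → Fin (suc k) → Fam₂) → Fin (suc k) → Fam₂
    expansionTerm N j Y₂ Yₘ = signed (toℕ j) (N zero j Y₂ Yₘ ⊗ detFam k (minor N j) Y₂ Yₘ)

  -- |L| = h + m, counted in the order of the two liftings
  |L| : ℕ
  |L| = m ℕ+ (h ℕ+ 0)

  |L|≡h+m : |L| ≡ h ℕ+ m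
  |L|≡h+m = ≡.trans (≡.cong (m ℕ+_) (+-identityʳℕ h)) (+-commℕ m h)

  coeff-sumY : ∀ (Φ : Fam₂) → coeff (sumY Φ) |L| ≈ S₂.coefficient 0 Φ
  coeff-sumY Φ = begin
    coeff (sumY Φ) e
      ≈⟨ at (ΣP.sum-concat (λ Y₂ → List.map (Φ Y₂) (allSubsets m)) (allSubsets h)) e ⟩
    coeff (sumP (List.map (λ Y₂ → sumP (List.map (Φ Y₂) (allSubsets m))) (allSubsets h))) e
      ≈⟨ coeff-sum-map (λ Y₂ → sumP (List.map (Φ Y₂) (allSubsets m))) (allSubsets h) ⟩
    sumL (List.map (λ Y₂ → coeff (sumP (List.map (Φ Y₂) (allSubsets m))) e) (allSubsets h))
      ≈⟨ ΣA.sum-cong (allSubsets h) (λ Y₂ →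
           trans (coeff-sum-map (Φ Y₂) (allSubsets m)) (sym (L₀.coefficient↑-sum m e (Φ Y₂)))) ⟩
    sumL (List.map (λ Y₂ → L₀.coefficient↑ m e (Φ Y₂)) (allSubsets h))
      ≈⟨ L₁.coefficient↑-sum h (h ℕ+ 0) Φ ⟨
    L₁.coefficient↑ h (h ℕ+ 0) Φ
      ∎
    where
    open ᴬ-Reasoning
    e = |L|
    coeff-sum-map : ∀ {X : Set} (φ : X → Poly) l →
                    coeff (sumP (List.map φ l)) e ≈ sumL (List.map (λ x → coeff (φ x) e) l)
    coeff-sum-map φ l = trans (coeff-sumP (List.map φ l) e) (reflexive (≡.cong sumL (≡.sym (map-∘ l))))

open CommutativeRing using (Carrier; _≈_; _+_; 0#; 1#)

lemma8 : ∀ {c ℓ} (R : CommutativeRing c ℓ) →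
         _≈_ R (_+_ R (1# R) (1# R)) (0# R) →
         (h m : ℕ) →
         (adj : Fin h ⊎ Fin h → Fin h ⊎ Fin h → Bool) →
         (∀ u v → adj u v ≡ true → adj v u ≡ true) →
         (∀ u → adj u u ≡ true → ⊥) →
         (s : Fin h) →
         (xE : Fin h ⊎ Fin h → Fin h ⊎ Fin h → Carrier R) →
         (xL : Fin h → Fin h → Fin m → Carrier R) →
         (∀ u v → adj u v ≡ true → u ≢ inj₁ s → v ≢ inj₁ s → _≈_ R (xE u v) (xE v u)) →
         (∀ u v d → adj (inj₁ u) (inj₁ v) ≡ true → u ≢ s → v ≢ s →
            _≈_ R (xL u v d) (xL v u d)) →
         _≈_ R (Construction.coeff R (Construction.Setting.q R h m adj xE xL) (h ℕ+ m))
               (Construction.coeff R (Construction.Setting.p R h m adj xE xL) (h ℕ+ m))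
lemma8 R char2 h m adj _ _ _ xE xL _ _ =
  subst (λ e → _≈_ R (coeff q e) (coeff p e)) |L|≡h+m (begin
    coeff q |L|                    ≈⟨ coeff-sumY (detFam h Mq) ⟩
    S₂.coefficient 0 (detFam h Mq) ≈⟨ F₂.sameLead⇒coefficient (det-sameLead h Mq Mp matrix-sameLead) ⟩
    S₂.coefficient 0 (detFam h Mp) ≈⟨ coeff-sumY (detFam h Mp) ⟨
    coeff p |L|                    ∎)
  where
  open Lemma8Proof R char2 h m adj xE xL
  open Construction R using (coeff)
  open Construction.Setting R h m adj xE xL using (p; q)
  open Relation.Binary.Reasoning.Setoid (CommutativeRing.setoid R)
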